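{- Let $P=p_1p_2\cdots p_n$ be a finite directed path in $\mathbb T$ such that there exists $j\in[4,n]$ such that for all $k\ge j$, $p_k$ has two neighbors $p_r,p_s\in\{p_1,\dots,p_{k-1}\}$ such that there is exactly one point which is empty with respect to the directed path $p_1p_2\cdots p_{k-1}$ and adjacent to both $p_r$ and $p_s$. Then for every $\delta\in\mathbb N$, there exists an oritatami system with a seed of size $j$ and delay $\delta$ which assembles $P$.
   Context: Triangular lattice: $\mathbb T=(\mathbb Z^2,\sim)$ with $(x,y)\sim(u,v)$ iff $(u,v)-(x,y)\in\{\pm(1,0),\pm(0,1),\pm(1,1)\}$. A directed path is a self-avoiding sequence of pairwise adjacent consecutive points of $\mathbb T$. A point is empty with respect to a directed path if it does not occur in it. Oritatami system $(B,w,\heartsuit,\delta,\alpha)$ with seed configuration $\sigma$: $B$ finite set of bead types, $w$ transcript, $\heartsuit$ symmetric attraction rule, delay $\delta$, arity $\alpha$. A configuration is a self-avoiding path in $\mathbb T$ labelled by a prefix of $w$ (after the seed) plus a set of bonds between adjacent positions $i,j$, $|i-j|>1$, with attracting bead types, each position in at most $\alpha$ bonds. Dynamics: $\mathscr D(S)=\bigcup_{c\in S}\arg\max_{\gamma}\max_{\eta}h(\eta)$ over 1-elongations $\gamma$ of $c$ and $\min(\delta-1,|w|-|\gamma|)$-elongations $\eta$ of $\gamma$ ($h$ = number of bonds). A system assembles a directed path $P$ if every terminal configuration of the system has directed path equal to $P$. -}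

module Defs where

open import Data.Nat using (ℕ; zero; suc; _+_; _∸_; _≤_; _<_; _⊓_; _≡ᵇ_)
open import Data.Integer as ℤ using (ℤ; +_; -[1+_])
open import Data.Bool using (Bool; true; false; _∨_; if_then_else_)
open import Data.Fin using (Fin)
open import Data.Maybe using (Maybe; just; nothing)
open import Data.Product using (Σ; ∃; ∃₂; _×_; _,_)
open import Data.List using (List; []; _∷_; _++_; length; take; drop)
open import Data.List.Membership.Propositional using (_∈_; _∉_)
open import Data.List.Relation.Unary.All using (All)
open import Data.List.Relation.Unary.Unique.Propositional using (Unique)
open import Data.List.Relation.Unary.Linked using (Linked)
open import Relation.Binary.PropositionalEquality using (_≡_; _≢_)
open import Relation.Nullary using (¬_)

-- The triangular lattice T = (Z^2, ~)

Point : Set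
Point = ℤ × ℤ

directions : List Point
directions =
  (+ 1 , + 0) ∷ (-[1+ 0 ] , + 0) ∷
  (+ 0 , + 1) ∷ (+ 0 , -[1+ 0 ]) ∷
  (+ 1 , + 1) ∷ (-[1+ 0 ] , -[1+ 0 ]) ∷ []

_~_ : Point → Point → Set
(x , y) ~ (u , v) = (u ℤ.- x , v ℤ.- y) ∈ directions

DirectedPath : List Point → Set
DirectedPath ps = Unique ps × Linked _~_ ps

EmptyWrt : List Point → Point → Set
EmptyWrt ps q = q ∉ ps

TwoNeighbourCondition : List Point → Point → Set
TwoNeighbourCondition pre pk =
  ∃₂ λ (pr ps : Point) →
    pr ∈ pre × ps ∈ pre × pr ≢ ps × pk ~ pr × pk ~ ps ×
    (∃ λ (e : Point) →
       (EmptyWrt pre e × e ~ pr × e ~ ps) ×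
       (∀ (e′ : Point) → EmptyWrt pre e′ × e′ ~ pr × e′ ~ ps → e′ ≡ e))

_!_ : {A : Set} → List A → ℕ → Maybe A
[] ! _ = nothing
(x ∷ xs) ! zero = just x
(x ∷ xs) ! suc n = xs ! n

-- Configurations over the bead types Fin nB.
-- Positions are 0-based indices into the path.  A bond is a pair (i , k)
-- with i < k.

record Config (nB : ℕ) : Set where
  constructor config
  field
    path   : List Point
    labels : List (Fin nB)
    bonds  : List (ℕ × ℕ)

open Config public

degree : ℕ → List (ℕ × ℕ) → ℕ
degree i [] = 0
degree i ((a , b) ∷ hs) =
  (if (i ≡ᵇ a) ∨ (i ≡ᵇ b) then 1 else 0) + degree i hs

h : {nB : ℕ} → Config nB → ℕ
h c = length (bonds c)

record OS : Set where
  field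
    nB      : ℕ
    w       : List (Fin nB)
    heart   : Fin nB → Fin nB → Bool
    heart-sym : ∀ a b → heart a b ≡ heart b a
    delay   : ℕ
    arity   : ℕ
    seed    : Config nB

module _ (S : OS) where
  open OS S

  ValidBond : Config nB → ℕ × ℕ → Set
  ValidBond c (i , k) =
    suc i < k ×
    (∃₂ λ p q → path c ! i ≡ just p × path c ! k ≡ just q × p ~ q) ×
    (∃₂ λ a b → labels c ! i ≡ just a × labels c ! k ≡ just b × heart a b ≡ true)

  Valid : Config nB → Set
  Valid c =
    DirectedPath (path c) ×
    length (labels c) ≡ length (path c) ×
    All (ValidBond c) (bonds c) ×
    Unique (bonds c) ×
    (∀ i → degree i (bonds c) ≤ arity)

  placed : Config nB → ℕ
  placed c = length (path c) ∸ length (labels seed)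

  _⊆ᵇ_ : List (ℕ × ℕ) → List (ℕ × ℕ) → Set
  H ⊆ᵇ H′ = ∀ {b} → b ∈ H → b ∈ H′

  Elongation : ℕ → Config nB → Config nB → Set
  Elongation k c c′ =
    Valid c′ ×
    (∃ λ ext → path c′ ≡ path c ++ ext × length ext ≡ k) ×
    labels c′ ≡ labels c ++ take k (drop (placed c) w) ×
    bonds c ⊆ᵇ bonds c′

  lookahead : Config nB → ℕ
  lookahead γ = (delay ∸ 1) ⊓ (length w ∸ placed γ)

  -- γ ∈ D({c}) :  γ ∈ argmax_{γ 1-elongation of c} max_η h(η)
  -- (the max over an empty set of η is taken to be -∞)
  Step : Config nB → Config nB → Set
  Step c γ =
    Elongation 1 c γ ×
    (∀ γ′ η′ → Elongation 1 c γ′ → Elongation (lookahead γ′) γ′ η′ →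
       ∃ λ η → Elongation (lookahead γ) γ η × h η′ ≤ h η)

  data Reachable : Config nB → Set where
    seed-reach : Reachable seed
    step-reach : ∀ {c c′} → Reachable c → Step c c′ → Reachable c′

  Terminal : Config nB → Set
  Terminal c = Reachable c × (∀ c′ → ¬ Step c c′)

  Assembles : List Point → Set
  Assembles P = ∀ c → Terminal c → path c ≡ P

  ValidSeed : Set
  ValidSeed = Valid seed

{-# OPTIONS --safe #-}
-- Use one bead type per point of P, and let bead k attract exactly the beads of the two
-- neighbours p_r, p_s that the hypothesis provides for p_k. The prefix of P realises every such
-- bond that is allowed (all but those between consecutive beads), and no configuration of the
-- same length can have more, since its bonds are among these. Hence every step must choose an
-- elongation whose best look-ahead realises them all; this puts the new bead next to both p_r
-- and p_s on an empty point, which by hypothesis is unique, so it is p_k. Neither the delay nor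
-- the arity (chosen large enough) ever binds.
module Submission where

open import Defs
open import Data.Nat using (ℕ; zero; suc; _+_; _∸_; _≤_; _<_; _⊓_; z≤n; s≤s; _<?_; _≤?_; _≟_; _≡ᵇ_)
open import Data.Nat.Properties
import Data.Integer as ℤ
open import Data.Integer.Tactic.RingSolver using (solve-∀)
open import Data.Fin using (Fin; toℕ; fromℕ<) renaming (zero to fzero; suc to fsuc)
open import Data.Fin.Properties using (toℕ-fromℕ<)
open import Data.Bool using (Bool; true; false; _∨_)
open import Data.Bool.Properties using (∨-comm)
open import Data.Maybe using (Maybe; just; nothing)
open import Data.Maybe.Properties using (just-injective)
open import Data.Product using (∃; ∃₂; _×_; _,_; proj₁; proj₂)
open import Data.Product.Properties using (≡-dec)
open import Data.Sum using (_⊎_; inj₁; inj₂)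
open import Data.List using (List; []; _∷_; _++_; length; take; drop; lookup; tabulate; allFin; [_]; map; filter)
open import Data.List.Properties using (length-++; length-take; length-drop; length-tabulate; take-all; drop-drop; ++-assoc)
open import Data.List.Membership.Propositional using (_∈_; _∉_)
open import Data.List.Membership.DecPropositional _≟_ using (_∈?_)
import Data.List.Membership.DecPropositional as DecMembership
open import Data.List.Membership.Propositional.Properties using (∈-∃++; ∈-filter⁺; ∈-filter⁻; ∈-map⁺; ∈-map⁻; ∈-++⁺ˡ; ∈-++⁺ʳ; ∈-++⁻)
open import Data.List.Relation.Binary.Subset.Propositional using (_⊆_)
open import Data.List.Relation.Unary.Any using (here; there)
open import Data.List.Relation.Unary.All as All using (All; []; _∷_)
open import Data.List.Relation.Unary.AllPairs using ([]; _∷_)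
open import Data.List.Relation.Unary.Unique.Propositional using (Unique)
import Data.List.Relation.Unary.Unique.Propositional.Properties as Unique
open import Data.List.Relation.Unary.Linked using (Linked; []; [-]; _∷_)
open import Relation.Binary.PropositionalEquality hiding ([_])
open import Relation.Nullary using (yes; no; does)
open import Data.Empty using (⊥; ⊥-elim)

module _ {A : Set} where

  !-take : ∀ m i (xs : List A) → i < m → take m xs ! i ≡ xs ! i
  !-take (suc m) i [] _ = refl
  !-take (suc m) zero (x ∷ xs) _ = refl
  !-take (suc m) (suc i) (x ∷ xs) (s≤s i<m) = !-take m i xs i<m

  !-take⁻ : ∀ m i (xs : List A) {a} → take m xs ! i ≡ just a → xs ! i ≡ just a
  !-take⁻ (suc m) zero (x ∷ xs) e = e
  !-take⁻ (suc m) (suc i) (x ∷ xs) e = !-take⁻ m i xs e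

  !⇒<length : ∀ (xs : List A) i {a} → xs ! i ≡ just a → i < length xs
  !⇒<length (x ∷ xs) zero _ = s≤s z≤n
  !⇒<length (x ∷ xs) (suc i) e = s≤s (!⇒<length xs i e)

  <length⇒! : ∀ (xs : List A) i → i < length xs → ∃ λ a → xs ! i ≡ just a
  <length⇒! (x ∷ xs) zero _ = x , refl
  <length⇒! (x ∷ xs) (suc i) (s≤s i<n) = <length⇒! xs i i<n

  !-++ˡ : ∀ (xs ys : List A) i → i < length xs → (xs ++ ys) ! i ≡ xs ! i
  !-++ˡ (x ∷ xs) ys zero _ = refl
  !-++ˡ (x ∷ xs) ys (suc i) (s≤s i<n) = !-++ˡ xs ys i i<n

  !-++ʳ : ∀ (xs ys : List A) i → (xs ++ ys) ! (length xs + i) ≡ ys ! i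
  !-++ʳ [] ys i = refl
  !-++ʳ (x ∷ xs) ys i = !-++ʳ xs ys i

  ∈⇒! : ∀ {x} (xs : List A) → x ∈ xs → ∃ λ i → xs ! i ≡ just x
  ∈⇒! (x ∷ xs) (here refl) = 0 , refl
  ∈⇒! (x ∷ xs) (there x∈) with i , e ← ∈⇒! xs x∈ = suc i , e

  !⇒∈ : ∀ (xs : List A) i {x} → xs ! i ≡ just x → x ∈ xs
  !⇒∈ (x ∷ xs) zero refl = here refl
  !⇒∈ (x ∷ xs) (suc i) e = there (!⇒∈ xs i e)

  !-lookup : ∀ (xs : List A) (i : Fin (length xs)) → xs ! toℕ i ≡ just (lookup xs i)
  !-lookup (x ∷ xs) fzero = refl
  !-lookup (x ∷ xs) (fsuc i) = !-lookup xs i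

  !-take-drop : ∀ (xs : List A) m {x} → xs ! m ≡ just x → take 1 (drop m xs) ≡ [ x ]
  !-take-drop (y ∷ xs) zero refl = refl
  !-take-drop (y ∷ xs) (suc m) e = !-take-drop xs m e

  !-tabulate : ∀ {n} (f : Fin n → A) i {a} → tabulate f ! i ≡ just a → ∃ λ t → toℕ t ≡ i × f t ≡ a
  !-tabulate {suc n} f zero refl = fzero , refl , refl
  !-tabulate {suc n} f (suc i) e with t , t≡i , ft≡a ← !-tabulate (λ t → f (fsuc t)) i e =
    fsuc t , cong suc t≡i , ft≡a

  Unique-!-injective : ∀ {xs : List A} → Unique xs → ∀ i k {x} → xs ! i ≡ just x → xs ! k ≡ just x → i ≡ k
  Unique-!-injective (_ ∷ _) zero zero _ _ = refl
  Unique-!-injective {y ∷ ys} (y∉ys ∷ _) zero (suc k) refl e = ⊥-elim (All.lookup y∉ys (!⇒∈ ys k e) refl)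
  Unique-!-injective {y ∷ ys} (y∉ys ∷ _) (suc i) zero e refl = ⊥-elim (All.lookup y∉ys (!⇒∈ ys i e) refl)
  Unique-!-injective (_ ∷ u) (suc i) (suc k) e f = cong suc (Unique-!-injective u i k e f)

  Unique-++-∷⇒∉ : ∀ (xs : List A) {x ys} → Unique (xs ++ x ∷ ys) → x ∉ xs
  Unique-++-∷⇒∉ (a ∷ as) (a∉ ∷ _) (here refl) = All.lookup a∉ (∈-++⁺ʳ as (here refl)) refl
  Unique-++-∷⇒∉ (a ∷ as) (_ ∷ u) (there x∈) = Unique-++-∷⇒∉ as u x∈

  Linked-! : ∀ {R : A → A → Set} {xs : List A} → Linked R xs →
             ∀ i {a b} → xs ! i ≡ just a → xs ! suc i ≡ just b → R a b
  Linked-! (r ∷ _) zero refl refl = r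
  Linked-! (_ ∷ l) (suc i) e f = Linked-! l i e f
  Linked-! [-] zero _ ()
  Linked-! [-] (suc i) () _

  Linked-take : ∀ {R : A → A → Set} {xs : List A} m → Linked R xs → Linked R (take m xs)
  Linked-take zero _ = []
  Linked-take (suc m) [] = []
  Linked-take (suc zero) [-] = [-]
  Linked-take (suc (suc m)) [-] = [-]
  Linked-take (suc zero) (_ ∷ _) = [-]
  Linked-take (suc (suc m)) (r ∷ l) = r ∷ Linked-take (suc m) l

  take-++-take-drop : ∀ m k (xs : List A) → take m xs ++ take k (drop m xs) ≡ take (m + k) xs
  take-++-take-drop zero k xs = refl
  take-++-take-drop (suc m) zero [] = refl
  take-++-take-drop (suc m) (suc k) [] = refl
  take-++-take-drop (suc m) k (x ∷ xs) = cong (x ∷_) (take-++-take-drop m k xs)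

  private
    ∈-++-∷⁻ : ∀ {y z} (as bs : List A) → y ≢ z → y ∈ as ++ z ∷ bs → y ∈ as ++ bs
    ∈-++-∷⁻ [] bs y≢z (here y≡z) = ⊥-elim (y≢z y≡z)
    ∈-++-∷⁻ [] bs _ (there y∈) = y∈
    ∈-++-∷⁻ (a ∷ as) bs _ (here y≡a) = here y≡a
    ∈-++-∷⁻ (a ∷ as) bs y≢z (there y∈) = there (∈-++-∷⁻ as bs y≢z y∈)

    length-++-∷ : ∀ (as bs : List A) {z} → length (as ++ z ∷ bs) ≡ suc (length (as ++ bs))
    length-++-∷ as bs {z} = begin
      length (as ++ z ∷ bs)          ≡⟨ length-++ as ⟩
      length as + suc (length bs)    ≡⟨ +-suc (length as) (length bs) ⟩
      suc (length as + length bs)    ≡⟨ cong suc (length-++ as) ⟨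
      suc (length (as ++ bs))        ∎
      where open ≡-Reasoning

  Unique-⊆⇒length-≤ : ∀ {xs ys : List A} → Unique xs → xs ⊆ ys → length xs ≤ length ys
  Unique-⊆⇒length-≤ {[]} _ _ = z≤n
  Unique-⊆⇒length-≤ {x ∷ xs} (x∉xs ∷ u) xs⊆ys with as , bs , refl ← ∈-∃++ (xs⊆ys (here refl)) =
    subst (suc (length xs) ≤_) (sym (length-++-∷ as bs))
      (s≤s (Unique-⊆⇒length-≤ u (λ y∈ → ∈-++-∷⁻ as bs (λ y≡x → All.lookup x∉xs y∈ (sym y≡x)) (xs⊆ys (there y∈)))))

  Unique-⊆-∌⇒length-< : ∀ {xs ys : List A} {y} → Unique xs → xs ⊆ ys → y ∈ ys → y ∉ xs → length xs < length ys
  Unique-⊆-∌⇒length-< {xs} u xs⊆ys y∈ys y∉xs with as , bs , refl ← ∈-∃++ y∈ys =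
    subst (length xs <_) (sym (length-++-∷ as bs))
      (s≤s (Unique-⊆⇒length-≤ u (λ x∈ → ∈-++-∷⁻ as bs (λ { refl → y∉xs x∈ }) (xs⊆ys x∈))))

degree-≤-length : ∀ i bs → degree i bs ≤ length bs
degree-≤-length i [] = z≤n
degree-≤-length i ((a , b) ∷ bs) with (i ≡ᵇ a) ∨ (i ≡ᵇ b)
... | true = s≤s (degree-≤-length i bs)
... | false = m≤n⇒m≤1+n (degree-≤-length i bs)

~-sym : ∀ {p q} → p ~ q → q ~ p
~-sym {x , y} {u , v} d = subst₂ (λ a b → (a , b) ∈ directions) (neg-minus u x) (neg-minus v y) (negate d)
  where
  neg-minus : ∀ a b → ℤ.- (a ℤ.- b) ≡ b ℤ.- a
  neg-minus = solve-∀
  negate : ∀ {a b} → (a , b) ∈ directions → (ℤ.- a , ℤ.- b) ∈ directions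
  negate (here refl) = there (here refl)
  negate (there (here refl)) = here refl
  negate (there (there (here refl))) = there (there (there (here refl)))
  negate (there (there (there (here refl)))) = there (there (here refl))
  negate (there (there (there (there (here refl))))) = there (there (there (there (there (here refl)))))
  negate (there (there (there (there (there (here refl)))))) = there (there (there (there (here refl))))

module Construction
  (P : List Point) (dp : DirectedPath P) (j : ℕ) (j≤n : j ≤ length P)
  (hyp : ∀ (i : Fin (length P)) → j ≤ suc (toℕ i) → TwoNeighbourCondition (take (toℕ i) P) (lookup P i))
  (δ : ℕ) where

  open DecMembership (≡-dec _≟_ _≟_) using () renaming (_∈?_ to _∈ᵇ?_)

  n : ℕ
  n = length P

  length-take-P : ∀ {L} → L ≤ n → length (take L P) ≡ L
  length-take-P L≤n = trans (length-take _ P) (m≤n⇒m⊓n≡m L≤n)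

  ∈-take-P⇒! : ∀ k {x} → x ∈ take k P → ∃ λ i → i < k × P ! i ≡ just x
  ∈-take-P⇒! k x∈ with i , e ← ∈⇒! (take k P) x∈ =
    i , ≤-trans (!⇒<length (take k P) i e) (≤-trans (≤-reflexive (length-take k P)) (m⊓n≤m k n)) , !-take⁻ k i P e

  !-take-P-++ : ∀ {m} ys i → m ≤ n → i < m → (take m P ++ ys) ! i ≡ P ! i
  !-take-P-++ {m} ys i m≤n i<m =
    trans (!-++ˡ (take m P) ys i (subst (i <_) (sym (length-take-P m≤n)) i<m)) (!-take m i P i<m)

  !-take-P-++-∷ : ∀ {m} q ys → m ≤ n → (take m P ++ q ∷ ys) ! m ≡ just q
  !-take-P-++-∷ {m} q ys m≤n =
    subst (λ i → (take m P ++ q ∷ ys) ! i ≡ just q) (trans (+-identityʳ _) (length-take-P m≤n)) (!-++ʳ (take m P) (q ∷ ys) 0)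

  record Anchors (k : ℕ) : Set where
    field
      pk pr ps e : Point
      r s : ℕ
      r<k : r < k
      s<k : s < k
      P!k : P ! k ≡ just pk
      P!r : P ! r ≡ just pr
      P!s : P ! s ≡ just ps
      r≢s : r ≢ s
      pk~pr : pk ~ pr
      pk~ps : pk ~ ps
      e-unique : ∀ e′ → EmptyWrt (take k P) e′ × e′ ~ pr × e′ ~ ps → e′ ≡ e

  anchorsOf : ∀ {k pk} → P ! k ≡ just pk → TwoNeighbourCondition (take k P) pk → Anchors k
  anchorsOf {k} {pk} P!k (pr , ps , pr∈ , ps∈ , pr≢ps , pk~pr , pk~ps , e , _ , e-unique)
    with r , r<k , P!r ← ∈-take-P⇒! k pr∈ | s , s<k , P!s ← ∈-take-P⇒! k ps∈ = record
      { pk = pk ; pr = pr ; ps = ps ; e = e ; r = r ; s = s ; r<k = r<k ; s<k = s<k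
      ; P!k = P!k ; P!r = P!r ; P!s = P!s
      ; r≢s = λ { refl → pr≢ps (just-injective (trans (sym P!r) P!s)) }
      ; pk~pr = pk~pr ; pk~ps = pk~ps ; e-unique = e-unique }

  anchors : ∀ k → k < n → j ≤ k → Anchors k
  anchors k k<n j≤k
    with hyp (fromℕ< k<n) (subst (λ i → j ≤ suc i) (sym (toℕ-fromℕ< k<n)) (m≤n⇒m≤1+n j≤k)) | !-lookup P (fromℕ< k<n)
  ... | condition | P!k rewrite toℕ-fromℕ< k<n = anchorsOf P!k condition

  anchors? : ∀ k → Maybe (Anchors k)
  anchors? k with k <? n | j ≤? k
  ... | yes k<n | yes j≤k = just (anchors k k<n j≤k)
  ... | _       | _       = nothing

  anchors?-just : ∀ k → j ≤ k → k < n → ∃ λ a → anchors? k ≡ just a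
  anchors?-just k j≤k k<n with k <? n | j ≤? k
  ... | yes _  | yes _  = _ , refl
  ... | yes _  | no j≰k = ⊥-elim (j≰k j≤k)
  ... | no k≮n | _      = ⊥-elim (k≮n k<n)

  indicesOf : ∀ {k} → Maybe (Anchors k) → List ℕ
  indicesOf nothing = []
  indicesOf (just a) = Anchors.r a ∷ Anchors.s a ∷ []

  anchorIndices : ℕ → List ℕ
  anchorIndices k = indicesOf (anchors? k)

  anchorIndices-unique : ∀ k → Unique (anchorIndices k)
  anchorIndices-unique k with anchors? k
  ... | nothing = []
  ... | just a = (Anchors.r≢s a ∷ []) ∷ [] ∷ []

  ∈-anchorIndices⇒< : ∀ k {i} → i ∈ anchorIndices k → i < k
  ∈-anchorIndices⇒< k with anchors? k
  ... | just a = λ { (here refl) → Anchors.r<k a ; (there (here refl)) → Anchors.s<k a }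

  ∈-anchorIndices⇒~ : ∀ k {i} → i ∈ anchorIndices k → ∃₂ λ p q → P ! i ≡ just p × P ! k ≡ just q × p ~ q
  ∈-anchorIndices⇒~ k with anchors? k
  ... | just a = λ
    { (here refl) → Anchors.pr a , Anchors.pk a , Anchors.P!r a , Anchors.P!k a , ~-sym {Anchors.pk a} {Anchors.pr a} (Anchors.pk~pr a)
    ; (there (here refl)) → Anchors.ps a , Anchors.pk a , Anchors.P!s a , Anchors.P!k a , ~-sym {Anchors.pk a} {Anchors.ps a} (Anchors.pk~ps a) }

  -- Bead k is meant to bond to p_r and p_s, except to its predecessor (consecutive beads cannot bond).
  intendedBonds : ℕ → List (ℕ × ℕ)
  intendedBonds zero = []
  intendedBonds (suc L) = intendedBonds L ++ map (_, L) (filter (λ i → suc i <? L) (anchorIndices L))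

  ∈-intendedBonds⁻ : ∀ L {i k} → (i , k) ∈ intendedBonds L → k < L × i ∈ anchorIndices k × suc i < k
  ∈-intendedBonds⁻ (suc L) b∈ with ∈-++⁻ (intendedBonds L) b∈
  ... | inj₁ b∈′ with k<L , i∈ , 1+i<k ← ∈-intendedBonds⁻ L b∈′ = m<n⇒m<1+n k<L , i∈ , 1+i<k
  ... | inj₂ b∈′ with _ , i∈ , refl ← ∈-map⁻ (_, L) b∈′ with i∈′ , 1+i<L ← ∈-filter⁻ (λ i → suc i <? L) i∈ =
    ≤-refl , i∈′ , 1+i<L

  ∈-intendedBonds⁺ : ∀ L {i k} → k < L → i ∈ anchorIndices k → suc i < k → (i , k) ∈ intendedBonds L
  ∈-intendedBonds⁺ (suc L) {i} {k} k<1+L i∈ 1+i<k with k ≟ L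
  ... | yes refl = ∈-++⁺ʳ (intendedBonds L) (∈-map⁺ (_, L) (∈-filter⁺ (λ i → suc i <? L) i∈ 1+i<k))
  ... | no k≢L = ∈-++⁺ˡ (∈-intendedBonds⁺ L (≤∧≢⇒< (≤-pred k<1+L) k≢L) i∈ 1+i<k)

  intendedBonds-mono : ∀ {L L′} → L ≤ L′ → intendedBonds L ⊆ intendedBonds L′
  intendedBonds-mono {L} {L′} L≤L′ {i , k} b∈ with k<L , i∈ , 1+i<k ← ∈-intendedBonds⁻ L b∈ =
    ∈-intendedBonds⁺ L′ (≤-trans k<L L≤L′) i∈ 1+i<k

  intendedBonds-unique : ∀ L → Unique (intendedBonds L)
  intendedBonds-unique zero = []
  intendedBonds-unique (suc L) = Unique.++⁺ (intendedBonds-unique L)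
    (Unique.map⁺ (cong proj₁) (Unique.filter⁺ (λ i → suc i <? L) (anchorIndices-unique L)))
    λ (b∈old , b∈new) → disjoint b∈old b∈new
    where
    disjoint : ∀ {b} → b ∈ intendedBonds L → b ∈ map (_, L) (filter (λ i → suc i <? L) (anchorIndices L)) → ⊥
    disjoint b∈old b∈new with _ , _ , refl ← ∈-map⁻ (_, L) b∈new = <-irrefl refl (proj₁ (∈-intendedBonds⁻ L b∈old))

  beads : List (Fin n)
  beads = allFin n

  length-beads : length beads ≡ n
  length-beads = length-tabulate (λ t → t)

  length-take-beads : ∀ {L} → L ≤ n → length (take L beads) ≡ L
  length-take-beads L≤n = trans (length-take _ beads) (trans (cong (_ ⊓_) length-beads) (m≤n⇒m⊓n≡m L≤n))

  !-take-beads : ∀ L i {a} → take L beads ! i ≡ just a → toℕ a ≡ i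
  !-take-beads L i e with _ , t≡i , refl ← !-tabulate (λ t → t) i (!-take⁻ L i beads e) = t≡i

  attracts : Fin n → Fin n → Bool
  attracts a b = does (toℕ a ∈? anchorIndices (toℕ b)) ∨ does (toℕ b ∈? anchorIndices (toℕ a))

  attracts⇒ : ∀ a b → attracts a b ≡ true → toℕ a ∈ anchorIndices (toℕ b) ⊎ toℕ b ∈ anchorIndices (toℕ a)
  attracts⇒ a b e with toℕ a ∈? anchorIndices (toℕ b) | toℕ b ∈? anchorIndices (toℕ a)
  ... | yes a∈ | _      = inj₁ a∈
  ... | no _   | yes b∈ = inj₂ b∈

  ∈⇒attracts : ∀ a b → toℕ a ∈ anchorIndices (toℕ b) → attracts a b ≡ true
  ∈⇒attracts a b a∈ with toℕ a ∈? anchorIndices (toℕ b)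
  ... | yes _ = refl
  ... | no a∉ = ⊥-elim (a∉ a∈)

  prefix : ℕ → Config n
  prefix L = config (take L P) (take L beads) (intendedBonds L)

  system : OS
  system = record
    { nB = n ; w = drop j beads ; heart = attracts
    ; heart-sym = λ a b → ∨-comm (does (toℕ a ∈? anchorIndices (toℕ b))) (does (toℕ b ∈? anchorIndices (toℕ a)))
    ; delay = δ ; arity = length (intendedBonds n) ; seed = prefix j }

  bead-at : ∀ {L i} → L ≤ n → i < L → ∃ λ a → take L beads ! i ≡ just a × toℕ a ≡ i
  bead-at {L} {i} L≤n i<L with a , a! ← <length⇒! (take L beads) i (subst (i <_) (sym (length-take-beads L≤n)) i<L) =
    a , a! , !-take-beads L i a!

  intendedBond-valid : ∀ {L} → L ≤ n → ∀ {b} → b ∈ intendedBonds L → ValidBond system (prefix L) b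
  intendedBond-valid {L} L≤n {i , k} b∈
    with k<L , i∈ , 1+i<k ← ∈-intendedBonds⁻ L b∈
    with p , q , P!i , P!k , p~q ← ∈-anchorIndices⇒~ k i∈
    with i<L ← <-trans (<-trans (n<1+n i) 1+i<k) k<L
    with a , a! , a≡i ← bead-at L≤n i<L | b , b! , b≡k ← bead-at L≤n k<L =
    1+i<k ,
    (p , q , trans (!-take L i P i<L) P!i , trans (!-take L k P k<L) P!k , p~q) ,
    (a , b , a! , b! , ∈⇒attracts a b (subst₂ (λ x y → x ∈ anchorIndices y) (sym a≡i) (sym b≡k) i∈))

  prefix-valid : ∀ {L} → L ≤ n → Valid system (prefix L)
  prefix-valid {L} L≤n =
    (Unique.take⁺ L (proj₁ dp) , Linked-take L (proj₂ dp)) ,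
    trans (length-take-beads L≤n) (sym (length-take-P L≤n)) ,
    All.tabulate (intendedBond-valid L≤n) ,
    intendedBonds-unique L ,
    λ i → ≤-trans (degree-≤-length i (intendedBonds L))
            (Unique-⊆⇒length-≤ (intendedBonds-unique L) (intendedBonds-mono L≤n))

  bonds⊆intendedBonds : ∀ {η L} → Valid system η → labels η ≡ take L beads → length (path η) ≡ L →
                        bonds η ⊆ intendedBonds L
  bonds⊆intendedBonds {η} {L} (_ , _ , valid , _) refl refl {i , k} b∈
    with 1+i<k , (_ , _ , _ , ηk , _) , (a , b , a! , b! , a♥b) ← All.lookup valid b∈
    with refl ← !-take-beads L i a! | refl ← !-take-beads L k b! with attracts⇒ a b a♥b
  ... | inj₁ i∈ = ∈-intendedBonds⁺ L (!⇒<length (path η) k ηk) i∈ 1+i<k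
  ... | inj₂ k∈ = ⊥-elim (<-asym (∈-anchorIndices⇒< (toℕ a) k∈) (<-trans (n<1+n _) 1+i<k))

  h≤intendedBonds : ∀ {η L} → Valid system η → labels η ≡ take L beads → length (path η) ≡ L →
                    h η ≤ length (intendedBonds L)
  h≤intendedBonds V@(_ , _ , _ , unique , _) lab len = Unique-⊆⇒length-≤ unique (bonds⊆intendedBonds V lab len)

  intendedBonds-≤h⇒⊆ : ∀ {η L} → Valid system η → labels η ≡ take L beads → length (path η) ≡ L →
                       length (intendedBonds L) ≤ h η → intendedBonds L ⊆ bonds η
  intendedBonds-≤h⇒⊆ {η} V@(_ , _ , _ , unique , _) lab len X≤h {b} b∈ with b ∈ᵇ? bonds η
  ... | yes b∈η = b∈η
  ... | no b∉η = ⊥-elim (<⇒≱ (Unique-⊆-∌⇒length-< unique (bonds⊆intendedBonds V lab len) b∈ b∉η) X≤h)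

  labels-after : ∀ {c m} k → j ≤ m → length (path c) ≡ m → labels c ≡ take m beads →
                 labels c ++ take k (drop (placed system c) (drop j beads)) ≡ take (m + k) beads
  labels-after {c} {m} k j≤m refl refl = begin
    take m beads ++ take k (drop (m ∸ length (take j beads)) (drop j beads))
      ≡⟨ cong (λ i → take m beads ++ take k (drop (m ∸ i) (drop j beads))) (length-take-beads j≤n) ⟩
    take m beads ++ take k (drop (m ∸ j) (drop j beads))
      ≡⟨ cong (λ xs → take m beads ++ take k xs) (drop-drop j (m ∸ j) beads) ⟩
    take m beads ++ take k (drop (j + (m ∸ j)) beads)
      ≡⟨ cong (λ i → take m beads ++ take k (drop i beads)) (m+[n∸m]≡n j≤m) ⟩
    take m beads ++ take k (drop m beads)
      ≡⟨ take-++-take-drop m k beads ⟩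
    take (m + k) beads ∎
    where open ≡-Reasoning

  elongation-shape : ∀ {c c′ m k} → j ≤ m → length (path c) ≡ m → labels c ≡ take m beads →
                     Elongation system k c c′ →
                     m + k ≤ n × length (path c′) ≡ m + k × labels c′ ≡ take (m + k) beads
  elongation-shape {c} {c′} {m} {k} j≤m len lab ((_ , labels≡path , _) , (ext , path≡ , len-ext) , lab′ , _) =
    m⊓n≡m⇒m≤n (begin
      (m + k) ⊓ n                   ≡⟨ cong ((m + k) ⊓_) length-beads ⟨
      (m + k) ⊓ length beads        ≡⟨ length-take (m + k) beads ⟨
      length (take (m + k) beads)   ≡⟨ cong length lab″ ⟨
      length (labels c′)            ≡⟨ labels≡path ⟩
      length (path c′)              ≡⟨ len′ ⟩
      m + k                         ∎) ,
    len′ , lab″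
    where
    open ≡-Reasoning
    lab″ = trans lab′ (labels-after {c} k j≤m len lab)
    len′ = trans (cong length path≡) (trans (length-++ (path c)) (cong₂ _+_ len len-ext))

  lookahead-≡ : ∀ {γ γ′} → length (path γ) ≡ length (path γ′) → lookahead system γ ≡ lookahead system γ′
  lookahead-≡ e = cong (λ ℓ → (δ ∸ 1) ⊓ (length (drop j beads) ∸ (ℓ ∸ length (take j beads)))) e

  +lookahead≤n : ∀ {γ M} → length (path γ) ≡ M → j ≤ M → M ≤ n → M + lookahead system γ ≤ n
  +lookahead≤n {γ} {M} refl j≤M M≤n = subst (M + lookahead system γ ≤_) (m+[n∸m]≡n M≤n)
    (+-monoʳ-≤ M (subst (lookahead system γ ≤_) beads-left (m⊓n≤n (δ ∸ 1) _)))
    where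
    open ≡-Reasoning
    beads-left : length (drop j beads) ∸ (M ∸ length (take j beads)) ≡ n ∸ M
    beads-left = begin
      length (drop j beads) ∸ (M ∸ length (take j beads))
        ≡⟨ cong₂ (λ a b → a ∸ (M ∸ b)) (trans (length-drop j beads) (cong (_∸ j) length-beads))
                                        (length-take-beads j≤n) ⟩
      (n ∸ j) ∸ (M ∸ j)   ≡⟨ ∸-+-assoc n j (M ∸ j) ⟩
      n ∸ (j + (M ∸ j))   ≡⟨ cong (n ∸_) (m+[n∸m]≡n j≤M) ⟩
      n ∸ M               ∎

  record Follows (c : Config n) (m : ℕ) : Set where
    field
      j≤m : j ≤ m
      m≤n : m ≤ n
      path≡ : path c ≡ take m P
      labels≡ : labels c ≡ take m beads
      bonds⊆ : bonds c ⊆ intendedBonds m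

    length-path : length (path c) ≡ m
    length-path = trans (cong length path≡) (length-take-P m≤n)

    elongation-shape′ : ∀ {c′ k} → Elongation system k c c′ →
                        m + k ≤ n × length (path c′) ≡ m + k × labels c′ ≡ take (m + k) beads
    elongation-shape′ = elongation-shape j≤m length-path labels≡

  prefix-follows : ∀ {m} → j ≤ m → m ≤ n → Follows (prefix m) m
  prefix-follows j≤m m≤n = record { j≤m = j≤m ; m≤n = m≤n ; path≡ = refl ; labels≡ = refl ; bonds⊆ = λ b∈ → b∈ }

  prefix-elongation : ∀ {c m} k → Follows c m → m + k ≤ n → Elongation system k c (prefix (m + k))
  prefix-elongation {c} {m} k f m+k≤n =
    prefix-valid m+k≤n ,
    (take k (drop m P) ,
     trans (sym (take-++-take-drop m k P)) (cong (_++ take k (drop m P)) (sym path≡)) ,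
     trans (length-take k (drop m P)) (trans (cong (k ⊓_) (length-drop m P)) (m≤n⇒m⊓n≡m k≤n∸m))) ,
    sym (labels-after {c} k j≤m length-path labels≡) ,
    (λ b∈ → intendedBonds-mono (m≤m+n m k) (bonds⊆ b∈))
    where
    open Follows f
    k≤n∸m : k ≤ n ∸ m
    k≤n∸m = subst (_≤ n ∸ m) (m+n∸m≡n m k) (∸-monoˡ-≤ m m+k≤n)

  -- Length of the look-ahead configurations whose bonds a step from length m maximises.
  horizon : ℕ → ℕ
  horizon m = m + 1 + lookahead system (prefix (m + 1))

  lookahead-elongation : ∀ {m} → j ≤ m → m + 1 ≤ n →
                         Elongation system (lookahead system (prefix (m + 1))) (prefix (m + 1)) (prefix (horizon m))
  lookahead-elongation {m} j≤m m+1≤n = prefix-elongation _ (prefix-follows j≤m+1 m+1≤n)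
    (+lookahead≤n {prefix (m + 1)} (length-take-P m+1≤n) j≤m+1 m+1≤n)
    where j≤m+1 = ≤-trans j≤m (m≤m+n m 1)

  lookahead-elongation-shape : ∀ {c γ η m} → Follows c m → Elongation system 1 c γ →
                               Elongation system (lookahead system γ) γ η →
                               m + 1 ≤ n × length (path η) ≡ horizon m × labels η ≡ take (horizon m) beads
  lookahead-elongation-shape {c} {γ} {η} {m} f E1 Eη
    with m+1≤n , lenγ , labγ ← Follows.elongation-shape′ f E1
    with _ , lenη , labη ← elongation-shape (≤-trans (Follows.j≤m f) (m≤m+n m 1)) lenγ labγ Eη =
    let la≡ = lookahead-≡ {γ} {prefix (m + 1)} (trans lenγ (sym (length-take-P m+1≤n)))
    in m+1≤n , trans lenη (cong (m + 1 +_) la≡) , trans labη (cong (λ ℓ → take (m + 1 + ℓ) beads) la≡)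

  prefix-step : ∀ {c m} → Follows c m → m < n → Step system c (prefix (m + 1))
  prefix-step {c} {m} f m<n =
    prefix-elongation 1 f m+1≤n ,
    λ γ η E1 Eη → let _ , lenη , labη = lookahead-elongation-shape f E1 Eη in
      prefix (horizon m) , lookahead-elongation (Follows.j≤m f) m+1≤n ,
      h≤intendedBonds (proj₁ Eη) labη lenη
    where m+1≤n = subst (_≤ n) (+-comm 1 m) m<n

  -- Comparing with the prefix of P, a step must pick a 1-elongation whose best look-ahead
  -- realises every intended bond.
  step-realises-intendedBonds : ∀ {c γ m} → Follows c m → Step system c γ →
                                ∃ λ η → Elongation system (lookahead system γ) γ η × intendedBonds (horizon m) ⊆ bonds η
  step-realises-intendedBonds {c} {γ} {m} f (E1 , argmax)
    with m+1≤n , _ ← Follows.elongation-shape′ f E1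
    with η , Eη , h≤ ← argmax (prefix (m + 1)) (prefix (horizon m)) (prefix-elongation 1 f m+1≤n)
                              (lookahead-elongation (Follows.j≤m f) m+1≤n)
    with _ , lenη , labη ← lookahead-elongation-shape f E1 Eη =
    η , Eη , intendedBonds-≤h⇒⊆ (proj₁ Eη) labη lenη h≤

  -- Bead m bonds to (or follows) both p_r and p_s, hence sits at their unique common empty neighbour.
  forced-point : ∀ {η m q ext L} → j ≤ m → m < n → m < L → Valid system η →
                 path η ≡ take m P ++ q ∷ ext → intendedBonds L ⊆ bonds η → P ! m ≡ just q
  forced-point {η} {m} {q} {ext} {L} j≤m m<n m<L ((unique , linked) , _ , valid , _) path≡ X⊆
    with a , a≡ ← anchors?-just m j≤m m<n =
    subst (λ x → P ! m ≡ just x)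
      (trans (e-unique pk (pk∉ , pk~pr , pk~ps)) (sym (e-unique q (q∉ , adjacent r∈ P!r , adjacent s∈ P!s))))
      P!k
    where
    open Anchors a
    m≤n = <⇒≤ m<n

    r∈ : r ∈ anchorIndices m
    r∈ = subst (λ x → r ∈ indicesOf x) (sym a≡) (here refl)

    s∈ : s ∈ anchorIndices m
    s∈ = subst (λ x → s ∈ indicesOf x) (sym a≡) (there (here refl))

    q∉ : q ∉ take m P
    q∉ = Unique-++-∷⇒∉ (take m P) (subst Unique path≡ unique)

    pk∉ : pk ∉ take m P
    pk∉ pk∈ with i , i<m , P!i ← ∈-take-P⇒! m pk∈ = <-irrefl (Unique-!-injective (proj₁ dp) i m P!i P!k) i<m

    η!m : path η ! m ≡ just q
    η!m = trans (cong (_! m) path≡) (!-take-P-++-∷ q ext m≤n)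

    adjacent : ∀ {i p} → i ∈ anchorIndices m → P ! i ≡ just p → q ~ p
    adjacent {i} {p} i∈ P!i = ~-sym {p} {q} p~q
      where
      i<m = ∈-anchorIndices⇒< m i∈
      η!i : path η ! i ≡ just p
      η!i = trans (cong (_! i) path≡) (trans (!-take-P-++ (q ∷ ext) i m≤n i<m) P!i)
      p~q : p ~ q
      p~q with suc i <? m
      ... | yes 1+i<m
        with _ , (_ , _ , η!i′ , η!m′ , p′~q′) , _ ← All.lookup valid (X⊆ (∈-intendedBonds⁺ L m<L i∈ 1+i<m)) =
        subst₂ _~_ (just-injective (trans (sym η!i′) η!i)) (just-injective (trans (sym η!m′) η!m)) p′~q′
      ... | no 1+i≮m =
        Linked-! linked i η!i (subst (λ k → path η ! k ≡ just q) (sym (≤-antisym i<m (≮⇒≥ 1+i≮m))) η!m)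

  step-path : ∀ {c γ m} → Follows c m → Step system c γ → path γ ≡ take (m + 1) P
  step-path f ((_ , ([] , _ , ()) , _) , _)
  step-path f ((_ , (_ ∷ _ ∷ _ , _ , ()) , _) , _)
  step-path {c} {γ} {m} f st@(E1@(_ , (q ∷ [] , pathγ≡ , _) , _) , _)
    with m+1≤n , _ ← Follows.elongation-shape′ f E1
    with η , (Vη , (ext′ , pathη≡ , _) , _) , X⊆ ← step-realises-intendedBonds f st =
    let pathγ≡′ = trans pathγ≡ (cong (_++ [ q ]) (Follows.path≡ f))
        pathη≡′ = trans pathη≡ (trans (cong (_++ ext′) pathγ≡′) (++-assoc (take m P) [ q ] ext′))
        m<n = subst (_≤ n) (+-comm m 1) m+1≤n
        m<horizon = ≤-trans (≤-reflexive (+-comm 1 m)) (m≤m+n (m + 1) _)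
        P!m = forced-point {η} (Follows.j≤m f) m<n m<horizon Vη pathη≡′ X⊆
    in begin
      path γ                          ≡⟨ pathγ≡′ ⟩
      take m P ++ [ q ]               ≡⟨ cong (take m P ++_) (!-take-drop P m P!m) ⟨
      take m P ++ take 1 (drop m P)   ≡⟨ take-++-take-drop m 1 P ⟩
      take (m + 1) P                  ∎
    where open ≡-Reasoning

  step-follows : ∀ {c γ m} → Follows c m → Step system c γ → Follows γ (m + 1)
  step-follows f st@(E1@(Vγ , _) , _)
    with m+1≤n , lenγ , labγ ← Follows.elongation-shape′ f E1 = record
      { j≤m = ≤-trans (Follows.j≤m f) (m≤m+n _ 1)
      ; m≤n = m+1≤n
      ; path≡ = step-path f st
      ; labels≡ = labγ
      ; bonds⊆ = bonds⊆intendedBonds Vγ labγ lenγ }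

  reachable-follows : ∀ {c} → Reachable system c → ∃ (Follows c)
  reachable-follows seed-reach = j , prefix-follows ≤-refl j≤n
  reachable-follows (step-reach r st) with m , f ← reachable-follows r = m + 1 , step-follows f st

  assembles : Assembles system P
  assembles c (r , terminal) with m , f ← reachable-follows r with m <? n
  ... | yes m<n = ⊥-elim (terminal _ (prefix-step f m<n))
  ... | no m≮n = begin
    path c       ≡⟨ Follows.path≡ f ⟩
    take m P     ≡⟨ take-all m P (≮⇒≥ m≮n) ⟩
    P            ∎
    where open ≡-Reasoning

lemma10 : (P : List Point) → DirectedPath P →
          (j : ℕ) → 4 ≤ j → j ≤ length P →
          (∀ (i : Fin (length P)) → j ≤ suc (toℕ i) →
             TwoNeighbourCondition (take (toℕ i) P) (lookup P i)) →
          (δ : ℕ) →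
          ∃ λ (S : OS) → ValidSeed S × length (Config.path (OS.seed S)) ≡ j ×
                         OS.delay S ≡ δ × Assembles S P
-- The construction works for every seed length.
lemma10 P dp j _ j≤n hyp δ = system , prefix-valid j≤n , length-take-P j≤n , refl , assembles
  where open Construction P dp j j≤n hyp δ
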